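{- Let $n\geq 2$ be an integer and let $\boldsymbol{\alpha}\in\operatorname{DNSG}(n)$. Then $\mathcal{T}_{n+1}(\boldsymbol{\alpha})\subseteq\operatorname{DNSG}(n+1)$.
   Context: The polynomials $\operatorname{R}_n\in\mathbb{Z}[X_1,X_2,\ldots]$ ($n\geq 2$) are defined recursively by $\operatorname{R}_2=0$ and $\operatorname{R}_{n+1}=A_n+\mathrm{L}(\operatorname{R}_n)+\mathrm{H}(\operatorname{R}_n)$, where $A_n=-\sum_{k=1}^{n-1}\binom{n}{k}X_{1+k}X_{1+n-k}X_n$, and $\mathrm{L},\mathrm{H}$ are the linear operators on polynomials defined on monomials by $\mathrm{L}(X_{\alpha_1}\cdots X_{\alpha_r})=\sum_{1\leq i<j\leq r}X_{\alpha_1}\cdots X_{\alpha_i+1}\cdots X_{\alpha_j+1}\cdots X_{\alpha_r}$ (the factors $X_{\alpha_i},X_{\alpha_j}$ replaced by $X_{\alpha_i+1},X_{\alpha_j+1}$) and $\mathrm{H}(X_{\alpha_1}\cdots X_{\alpha_r})=-\frac12\sum_{k=1}^r\sum_{l=1}^{\alpha_k-1}\binom{\alpha_k}{l}X_{1+l}X_{1+\alpha_k-l}\prod_{i\neq k}X_{\alpha_i}$, for positive integers $\alpha_1,\ldots,\alpha_r$. For a finite sequence $\boldsymbol{\alpha}=(\alpha_1,\ldots,\alpha_r)$ write $X_{\boldsymbol{\alpha}}=X_{\alpha_1}\cdots X_{\alpha_r}$. $I_m$ is the set of integer sequences $(\alpha_1,\ldots,\alpha_r)$ with $r\geq 3$,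 $\alpha_1\geq\cdots\geq\alpha_r$, $2\leq\alpha_k\leq m-1$ and $\sum_k\alpha_k=2m$; writing $\operatorname{R}_m=\sum_{\boldsymbol{\alpha}\in I_m}c^{(m)}_{\boldsymbol{\alpha}}X_{\boldsymbol{\alpha}}$, $I_m^*$ is the set of $\boldsymbol{\alpha}\in I_m$ with $c^{(m)}_{\boldsymbol{\alpha}}\neq0$. For a sequence $\boldsymbol{\alpha}$, $\mathcal{T}_{n+1}(\boldsymbol{\alpha})$ is the set of $\boldsymbol{\beta}\in I^*_{n+1}$ such that the coefficient of $X_{\boldsymbol{\beta}}$ in $\mathrm{L}(X_{\boldsymbol{\alpha}})$ or in $\mathrm{H}(X_{\boldsymbol{\alpha}})$ is nonzero. $\operatorname{DNSG}(m)$ is the set of finite integer sequences $(d_1,\ldots,d_r)$ with $r\geq 3$ such that $d_1\geq\cdots\geq d_r\geq 2$, $\sum_{k=1}^r d_k=2m$, and $d_1\leq d_2+\cdots+d_r-2r+4$. -}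

module Defs where

open import Data.Nat using (ℕ; zero; suc; _+_; _*_; _∸_; _≤_; _≤ᵇ_)
open import Data.Nat.Combinatorics using (_C_)
open import Data.Integer using (+_)
open import Data.Rational using (ℚ; _/_; -½; 0ℚ; 1ℚ) renaming (_*_ to _*ℚ_; _+_ to _+ℚ_; -_ to -ℚ_)
open import Data.Bool using (if_then_else_)
open import Data.List using (List; []; _∷_; _++_; map; concatMap; length; upTo; foldr)
open import Data.Nat.ListAction using (sum)
open import Data.List.Relation.Unary.All using (All)
open import Data.List.Relation.Unary.Linked using (Linked)
open import Data.List.Properties using (≡-dec)
open import Data.Nat.Properties using (_≟_)
open import Data.Product using (_×_; _,_)
open import Data.Sum using (_⊎_)
open import Relation.Binary.PropositionalEquality using (_≡_; _≢_)
open import Relation.Nullary.Decidable using (does)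

-- Monomial X_{a1}...X_{ar} represented by the list of indices (unordered).
Mono : Set
Mono = List ℕ

-- Polynomial (over ℚ ⊇ ℤ) as a formal finite sum of (coefficient, monomial).
Poly : Set
Poly = List (ℚ × Mono)

-- descending insertion sort (canonical form of a monomial)
insertD : ℕ → List ℕ → List ℕ
insertD x [] = x ∷ []
insertD x (y ∷ ys) = if y ≤ᵇ x then x ∷ y ∷ ys else y ∷ insertD x ys

sortD : List ℕ → List ℕ
sortD [] = []
sortD (x ∷ xs) = insertD x (sortD xs)

-- coefficient of X_β (β a descending sequence) in P
coeff : Poly → List ℕ → ℚ
coeff [] β = 0ℚ
coeff ((c , m) ∷ P) β =
  if does (≡-dec _≟_ (sortD m) β) then c +ℚ coeff P β else coeff P β

scale : ℚ → Poly → Poly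
scale c = map (λ { (d , m) → (c *ℚ d , m) })

incEach : Mono → List Mono
incEach [] = []
incEach (x ∷ xs) = (suc x ∷ xs) ∷ map (x ∷_) (incEach xs)

-- L on a monomial: sum over pairs i < j of incrementing both factors
Lmono : Mono → Poly
Lmono [] = []
Lmono (x ∷ xs) =
  map (λ m → (1ℚ , suc x ∷ m)) (incEach xs) ++ (map (λ { (c , m) → (c , x ∷ m) }) (Lmono xs))

-- the split terms of one factor X_a : -1/2 Σ_{l=1}^{a-1} C(a,l) X_{1+l} X_{1+a-l}
split : ℕ → Poly
split a = map (λ l → (-½ *ℚ ((+ (a C suc l)) / 1) , suc (suc l) ∷ suc (a ∸ suc l) ∷ []))
              (upTo (a ∸ 1))

Hmono : Mono → Poly
Hmono [] = []
Hmono (x ∷ xs) =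
  map (λ { (c , m) → (c , m ++ xs) }) (split x) ++ map (λ { (c , m) → (c , x ∷ m) }) (Hmono xs)

Lop : Poly → Poly
Lop = concatMap (λ { (c , m) → scale c (Lmono m) })

Hop : Poly → Poly
Hop = concatMap (λ { (c , m) → scale c (Hmono m) })

-- A_n = - Σ_{k=1}^{n-1} C(n,k) X_{1+k} X_{1+n-k} X_n
A : ℕ → Poly
A n = map (λ k → (-ℚ ((+ (n C suc k)) / 1) , suc (suc k) ∷ suc (n ∸ suc k) ∷ n ∷ []))
          (upTo (n ∸ 1))

-- R n  (meaningful for n ≥ 2; R 0 = R 1 = R 2 = 0)
R : ℕ → Poly
R zero = []
R (suc zero) = []
R (suc (suc zero)) = []
R (suc (suc (suc m))) = A (suc (suc m)) ++ Lop (R (suc (suc m))) ++ Hop (R (suc (suc m)))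

_≥_ : ℕ → ℕ → Set
a ≥ b = b ≤ a

record InI (m : ℕ) (β : List ℕ) : Set where
  field
    len   : 3 ≤ length β
    desc  : Linked _≥_ β
    lower : All (λ b → 2 ≤ b) β
    upper : All (λ b → b ≤ m ∸ 1) β
    total : sum β ≡ 2 * m

InIstar : ℕ → List ℕ → Set
InIstar m β = InI m β × coeff (R m) β ≢ 0ℚ

-- T_{n+1}(α), with n+1 passed as the first argument
InT : ℕ → List ℕ → List ℕ → Set
InT n1 α β = InIstar n1 β × (coeff (Lmono α) β ≢ 0ℚ ⊎ coeff (Hmono α) β ≢ 0ℚ)

DNSG : ℕ → List ℕ → Set
DNSG m [] = Data.Empty.⊥ where import Data.Empty
DNSG m (d₁ ∷ ds) =
  (3 ≤ length (d₁ ∷ ds)) × Linked _≥_ (d₁ ∷ ds) × All (λ b → 2 ≤ b) (d₁ ∷ ds)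
  × (sum (d₁ ∷ ds) ≡ 2 * m)
  -- d₁ ≤ d₂+…+d_r − 2r + 4, written without truncated subtraction
  × (d₁ + 2 * length (d₁ ∷ ds) ≤ sum ds + 4)

-- Given sum d = 2m, the DNSG inequality d₁ + 2r ≤ d₂ + ⋯ + d_r + 4 says exactly that
-- d₁ + r ≤ m + 2.  Every monomial of L(X_α) has r factors, each at most d₁ + 1, and every
-- monomial of H(X_α) has r + 1 factors, each at most d₁.  So passing from α to β raises
-- "largest part + number of parts" by at most one, as m + 2 does; membership of β in
-- I_{n+1} supplies the remaining conditions of DNSG(n + 1).
module Submission where

open import Defs
open import Data.Nat using (ℕ; suc; _+_; _*_; _≤_; _≤ᵇ_; s≤s)
open import Data.Nat.Properties
open import Data.Nat.Tactic.RingSolver using (solve-∀)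
open import Data.List using (List; []; _∷_; length)
open import Data.List.Relation.Unary.All as All using (All; []; _∷_; lookupAny)
open import Data.List.Relation.Unary.All.Properties using (++⁺; map⁺; applyUpTo⁺₁)
open import Data.List.Relation.Unary.Any using (Any; here; there)
open import Data.List.Relation.Unary.Linked.Properties using (Linked⇒All)
open import Data.List.Relation.Binary.Permutation.Propositional using (_↭_; prep; swap; ↭-refl; ↭-sym; ↭-trans)
open import Data.List.Relation.Binary.Permutation.Propositional.Properties using (All-resp-↭; ↭-length)
open import Data.List.Properties using (≡-dec; length-++)
open import Data.Bool using (true; false)
open import Data.Product using (_×_; _,_; proj₂)
open import Data.Sum using (_⊎_; inj₁; inj₂)
open import Data.Rational using (0ℚ)
open import Data.Empty using (⊥-elim)
open import Function using (_∘_)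
open import Relation.Binary.PropositionalEquality using (_≡_; _≢_; refl; sym; trans; cong; subst; subst₂; module ≡-Reasoning)
open import Relation.Nullary using (yes; no)

Bounded : ℕ → ℕ → Mono → Set
Bounded k B m = length m ≡ k × All (_≤ B) m

Monomials : (Mono → Set) → Poly → Set
Monomials Q = All (Q ∘ proj₂)

insertD-↭ : ∀ x ys → insertD x ys ↭ x ∷ ys
insertD-↭ x [] = ↭-refl
insertD-↭ x (y ∷ ys) with y ≤ᵇ x
... | true  = ↭-refl
... | false = ↭-trans (prep y (insertD-↭ x ys)) (swap y x ↭-refl)

sortD-↭ : ∀ xs → sortD xs ↭ xs
sortD-↭ []       = ↭-refl
sortD-↭ (x ∷ xs) = ↭-trans (insertD-↭ x (sortD xs)) (prep x (sortD-↭ xs))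

Bounded-resp-↭ : ∀ {k B xs ys} → xs ↭ ys → Bounded k B xs → Bounded k B ys
Bounded-resp-↭ p (len , bnd) = trans (sym (↭-length p)) len , All-resp-↭ p bnd

coeff≢0⇒Any : ∀ P β → coeff P β ≢ 0ℚ → Any ((_≡ β) ∘ sortD ∘ proj₂) P
coeff≢0⇒Any []            β nz = ⊥-elim (nz refl)
coeff≢0⇒Any ((c , m) ∷ P) β nz with ≡-dec _≟_ (sortD m) β
... | yes sorts = here sorts
... | no  _     = there (coeff≢0⇒Any P β nz)

head+length≤ : ∀ {k B b bs} → Bounded k B (b ∷ bs) → b + length (b ∷ bs) ≤ B + k
head+length≤ (refl , b≤B ∷ _) = +-monoˡ-≤ _ b≤B

coeff≢0⇒head+length≤ : ∀ {k B b bs} P → Monomials (Bounded k B) P →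
  coeff P (b ∷ bs) ≢ 0ℚ → b + length (b ∷ bs) ≤ B + k
coeff≢0⇒head+length≤ {b = b} {bs} P bounded nz
  with lookupAny bounded (coeff≢0⇒Any P (b ∷ bs) nz)
... | bounded-m , sorts =
  head+length≤ (subst (Bounded _ _) sorts (Bounded-resp-↭ (↭-sym (sortD-↭ _)) bounded-m))

incEach-bounded : ∀ {B} xs → All (_≤ B) xs → All (Bounded (length xs) (suc B)) (incEach xs)
incEach-bounded []       []         = []
incEach-bounded (x ∷ xs) (x≤B ∷ xs≤B) =
  (refl , s≤s x≤B ∷ All.map m≤n⇒m≤1+n xs≤B)
  ∷ map⁺ (All.map (λ { (len , bnd) → cong suc len , m≤n⇒m≤1+n x≤B ∷ bnd })
                  (incEach-bounded xs xs≤B))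

Lmono-bounded : ∀ {B} xs → All (_≤ B) xs → Monomials (Bounded (length xs) (suc B)) (Lmono xs)
Lmono-bounded []       []         = []
Lmono-bounded (x ∷ xs) (x≤B ∷ xs≤B) =
  ++⁺ (map⁺ (All.map (λ { (len , bnd) → cong suc len , s≤s x≤B ∷ bnd })
                     (incEach-bounded xs xs≤B)))
      (map⁺ (All.map (λ { (len , bnd) → cong suc len , m≤n⇒m≤1+n x≤B ∷ bnd })
                     (Lmono-bounded xs xs≤B)))

split-bounded : ∀ a → Monomials (Bounded 2 a) (split a)
split-bounded 0       = []
split-bounded (suc a) = map⁺ (applyUpTo⁺₁ _ a (λ {l} l<a → refl , s≤s l<a ∷ s≤s (m∸n≤m a l) ∷ []))

Hmono-bounded : ∀ {B} xs → All (_≤ B) xs → Monomials (Bounded (suc (length xs)) B) (Hmono xs)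
Hmono-bounded []       []         = []
Hmono-bounded (x ∷ xs) (x≤B ∷ xs≤B) =
  ++⁺ (map⁺ (All.map (λ { {_ , m} (len , bnd) →
                          trans (length-++ m) (cong (_+ length xs) len)
                          , ++⁺ (All.map (λ y≤x → ≤-trans y≤x x≤B) bnd) xs≤B })
                     (split-bounded x)))
      (map⁺ (All.map (λ { (len , bnd) → cong suc len , x≤B ∷ bnd })
                     (Hmono-bounded xs xs≤B)))

module _ {d s m r : ℕ} (total : d + s ≡ 2 * m) where

  private
    twice-head+length : (d + 2 * r) + d ≡ 2 * (d + r)
    twice-head+length = identity d r
      where
      identity : ∀ d r → (d + 2 * r) + d ≡ 2 * (d + r)
      identity = solve-∀

    twice-bound : (s + 4) + d ≡ 2 * (m + 2)
    twice-bound = begin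
      (s + 4) + d   ≡⟨ identity₁ s d ⟩
      (d + s) + 4   ≡⟨ cong (_+ 4) total ⟩
      2 * m + 4     ≡⟨ identity₂ m ⟩
      2 * (m + 2)   ∎
      where
      open ≡-Reasoning
      identity₁ : ∀ s d → (s + 4) + d ≡ (d + s) + 4
      identity₁ = solve-∀
      identity₂ : ∀ m → 2 * m + 4 ≡ 2 * (m + 2)
      identity₂ = solve-∀

  excess⇒head+length≤ : d + 2 * r ≤ s + 4 → d + r ≤ m + 2
  excess⇒head+length≤ h =
    *-cancelˡ-≤ 2 (subst₂ _≤_ twice-head+length twice-bound (+-monoˡ-≤ d h))

  head+length≤⇒excess : d + r ≤ m + 2 → d + 2 * r ≤ s + 4
  head+length≤⇒excess h =
    +-cancelʳ-≤ d _ _ (subst₂ _≤_ (sym twice-head+length) (sym twice-bound) (*-monoʳ-≤ 2 h))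

lemma3p2 : (n : ℕ) → 2 ≤ n → (α : List ℕ) → DNSG n α →
    (β : List ℕ) → InT (suc n) α β → DNSG (suc n) β
lemma3p2 n _ []       ()  _ _
lemma3p2 n _ (a ∷ as) _ [] ((β∈I , _) , _) = ⊥-elim (n≮0 (InI.len β∈I))
lemma3p2 n _ (a ∷ as) (_ , desc , _ , total , excess) (b ∷ bs) ((β∈I , _) , L⊎H) =
  InI.len β∈I , InI.desc β∈I , InI.lower β∈I , InI.total β∈I ,
  head+length≤⇒excess {m = suc n} (InI.total β∈I) (≤-trans (β-head+length≤ L⊎H) (s≤s α-bound))
  where
  r : ℕ
  r = length (a ∷ as)

  α-bound : a + r ≤ n + 2
  α-bound = excess⇒head+length≤ total excess

  parts≤a : All (_≤ a) (a ∷ as)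
  parts≤a = Linked⇒All (λ p q → ≤-trans q p) ≤-refl desc

  β-head+length≤ : coeff (Lmono (a ∷ as)) (b ∷ bs) ≢ 0ℚ ⊎ coeff (Hmono (a ∷ as)) (b ∷ bs) ≢ 0ℚ →
                   b + length (b ∷ bs) ≤ suc (a + r)
  β-head+length≤ (inj₁ nz) = coeff≢0⇒head+length≤ _ (Lmono-bounded (a ∷ as) parts≤a) nz
  β-head+length≤ (inj₂ nz) = ≤-trans (coeff≢0⇒head+length≤ _ (Hmono-bounded (a ∷ as) parts≤a) nz)
                                     (≤-reflexive (+-suc a r))
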